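{- Let $\mathbb{A}$ be a non-empty set, $x=x_1x_2x_3\cdots\in\mathbb{A}^{\mathbb N}$ and $k$ a positive integer. Let $u_1,u_2,\ldots,u_{2k+1}\in\mathbb{A}^+$ and suppose $x\in\{u_1,u_2\}^{\mathbb N}\cap\{u_2,u_3\}^{\mathbb N}\cap\cdots\cap\{u_{2k},u_{2k+1}\}^{\mathbb N}\cap\{u_{2k+1},u_1\}^{\mathbb N}$. Then $x$ is periodic.
   Context: $\mathbb{A}^+$ is the set of non-empty finite words over $\mathbb{A}$. For $A\subseteq\mathbb{A}^+$, $x\in A^{\mathbb N}$ means $x=v_1v_2v_3\cdots$ with $v_i\in A$ for all $i\geq1$. An infinite word $x$ is periodic if $x=uuu\cdots$ for some $u\in\mathbb{A}^+$. -}

module Defs where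

open import Data.Nat using (ℕ; zero; suc; _+_)
open import Data.Fin using (Fin; toℕ)
open import Data.List using (List; length; lookup)
open import Data.List.NonEmpty using (List⁺; toList)
open import Data.Product using (Σ; _×_)
open import Data.Sum using (_⊎_)
open import Relation.Binary.PropositionalEquality using (_≡_)

-- Infinite words over A: x = x₀ x₁ x₂ ⋯ (positions indexed from 0).
InfWord : Set → Set
InfWord A = ℕ → A

startPos : {A : Set} → (ℕ → List⁺ A) → ℕ → ℕ
startPos v zero    = 0
startPos v (suc i) = startPos v i + length (toList (v i))

-- x = v₀ v₁ v₂ ⋯ : the i-th (non-empty) factor occupies the positions
-- startPos v i , … , startPos v i + |v i| - 1 of x.  Since every factor is
-- non-empty, these blocks cover all of ℕ.
IsConcat : {A : Set} → (ℕ → List⁺ A) → InfWord A → Set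
IsConcat v x = ∀ i (j : Fin (length (toList (v i)))) →
  x (startPos v i + toℕ j) ≡ lookup (toList (v i)) j

_∈Pair^ℕ_,_ : {A : Set} → InfWord A → List⁺ A → List⁺ A → Set
x ∈Pair^ℕ u , w = Σ (ℕ → List⁺ _) λ v → (∀ i → (v i ≡ u) ⊎ (v i ≡ w)) × IsConcat v x

Periodic : {A : Set} → InfWord A → Set
Periodic {A} x = Σ (List⁺ A) λ u → IsConcat (λ _ → u) x

-- Order the letters. If y ∈ {s , t}^ℕ then y is lexicographically at least
-- min (s^ω , t^ω), and, for the reversed order, at most max (s^ω , t^ω). Applied
-- to the factorisations of x, x never lies strictly on the same side of
-- u_i^ω and u_{i+1}^ω, so going around the odd cycle u_1 , … , u_{2k+1} , u_1
-- the side cannot strictly alternate and x agrees with some u_i^ω.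
-- As A has no order (nor decidable equality), this is done for each prefix
-- length N on a relabelled copy of x whose letters are positions (i , j) in the
-- words u_i, identified just enough for all factorisations to agree on the
-- first N letters. Taking N > j + qL for L the product of the |u_i| gives
-- x (j + qL) = x j, so x is periodic.

module Submission where

open import Defs
open import Data.Bool using (Bool; true; false; not)
open import Data.Bool.Properties using (not-involutive)
open import Data.Empty using (⊥; ⊥-elim)
open import Data.Fin using (Fin; toℕ; fromℕ<)
open import Data.Fin.Properties using (toℕ-fromℕ<; toℕ<n)
open import Data.List using (List; []; _∷_; length; lookup; applyUpTo; upTo; cartesianProduct)
  renaming (map to mapˡ)
open import Data.List.Membership.Propositional.Properties
  using (∈-map⁺; ∈-cartesianProduct⁺; ∈-upTo⁺; ∈-applyUpTo⁺)
open import Data.List.NonEmpty using (List⁺; _∷_; head; tail; toList) renaming (map to map⁺)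
open import Data.List.Properties using (length-map; length-applyUpTo; lookup-applyUpTo; map-applyUpTo)
open import Data.List.Relation.Unary.All as All using (All; []; _∷_)
open import Data.List.Relation.Unary.All.Properties using (applyUpTo⁺₂) renaming (map⁺ to All-map⁺)
open import Data.Nat
  using (ℕ; zero; suc; _+_; _*_; _∸_; _≤_; _<_; z≤n; s≤s; z<s; _<?_; _≟_; _%_; >-nonZero⁻¹)
open import Data.Nat.DivMod using ([m+n]%n≡m%n; [m+kn]%n≡m%n; m<n⇒m%n≡m)
open import Data.Nat.Divisibility using (_∣_; divides)
open import Data.Nat.Induction using (<-rec)
open import Data.Nat.ListAction using (product)
open import Data.Nat.ListAction.Properties using (∈⇒∣product; product≢0)
open import Data.Nat.Properties
open import Data.Product using (Σ-syntax; ∃-syntax; _×_; _,_; proj₁; proj₂)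
open import Data.Product.Properties using (≡-dec)
open import Data.Product.Relation.Binary.Lex.Strict using (×-Lex; ×-transitive; ×-compare)
open import Data.Product.Relation.Binary.Pointwise.NonDependent using (≡×≡⇒≡; ≡⇒≡×≡)
open import Data.Sum using (_⊎_; inj₁; inj₂) renaming (map to map⊎; swap to swap⊎)
open import Function using (_∘_; id)
open import Relation.Binary.Definitions
  using (DecidableEquality; Transitive; Trichotomous; tri<; tri≈; tri>)
import Relation.Binary.Construct.Flip.EqAndOrd as Flip
open import Relation.Binary.PropositionalEquality
open import Relation.Nullary using (¬_; yes; no)

private
  variable
    K L : Set

infixr 5 _++ʷ_

_++ʷ_ : List K → InfWord K → InfWord K
([]      ++ʷ f) n       = f n
((a ∷ w) ++ʷ f) zero    = a
((a ∷ w) ++ʷ f) (suc n) = (w ++ʷ f) n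

drop : ℕ → InfWord K → InfWord K
drop p x n = x (p + n)

lookupᵈ : K → List K → ℕ → K
lookupᵈ d []      n       = d
lookupᵈ d (a ∷ w) zero    = a
lookupᵈ d (a ∷ w) (suc n) = lookupᵈ d w n

lookupᵈ-toℕ : ∀ d (w : List K) j → lookupᵈ d w (toℕ j) ≡ lookup w j
lookupᵈ-toℕ d (a ∷ w) Fin.zero    = refl
lookupᵈ-toℕ d (a ∷ w) (Fin.suc j) = lookupᵈ-toℕ d w j

applyUpTo-lookupᵈ : ∀ d (w : List K) → applyUpTo (lookupᵈ d w) (length w) ≡ w
applyUpTo-lookupᵈ d []      = refl
applyUpTo-lookupᵈ d (a ∷ w) = cong (a ∷_) (applyUpTo-lookupᵈ d w)

++ʷ-lookup : ∀ (w : List K) f j → (w ++ʷ f) (toℕ j) ≡ lookup w j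
++ʷ-lookup (a ∷ w) f Fin.zero    = refl
++ʷ-lookup (a ∷ w) f (Fin.suc j) = ++ʷ-lookup w f j

++ʷ-intro : ∀ (w : List K) {f g} → (∀ j → f (toℕ j) ≡ lookup w j) →
            drop (length w) f ≗ g → f ≗ w ++ʷ g
++ʷ-intro []      _      f≗g n       = f≗g n
++ʷ-intro (a ∷ w) lookups f≗g zero    = lookups Fin.zero
++ʷ-intro (a ∷ w) lookups f≗g (suc n) = ++ʷ-intro w (lookups ∘ Fin.suc) f≗g n

++ʷ-map : ∀ (h : K → L) w f → mapˡ h w ++ʷ h ∘ f ≗ h ∘ (w ++ʷ f)
++ʷ-map h []      f n       = refl
++ʷ-map h (a ∷ w) f zero    = refl
++ʷ-map h (a ∷ w) f (suc n) = ++ʷ-map h w f n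

∣_∣ : List⁺ K → ℕ
∣ w ∣ = length (toList w)

suc-∸-∣∣-< : ∀ M (t : List⁺ K) → suc M ∸ ∣ t ∣ < suc M
suc-∸-∣∣-< M t = s≤s (m∸n≤m M (length (tail t)))

infix 10 _^ω

_^ω : List⁺ K → InfWord K
(t ^ω) n = lookupᵈ (head t) (toList t) (n % ∣ t ∣)

^ω-unfold : ∀ (t : List⁺ K) → t ^ω ≗ toList t ++ʷ t ^ω
^ω-unfold t = ++ʷ-intro (toList t)
  (λ j → trans (cong (lookupᵈ (head t) (toList t)) (m<n⇒m%n≡m (toℕ<n j)))
               (lookupᵈ-toℕ (head t) (toList t) j))
  (λ n → cong (lookupᵈ (head t) (toList t))
               (trans (cong (_% ∣ t ∣) (+-comm ∣ t ∣ n)) ([m+n]%n≡m%n n ∣ t ∣)))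

^ω-periodic : ∀ (t : List⁺ K) c n → (t ^ω) (n + c * ∣ t ∣) ≡ (t ^ω) n
^ω-periodic t c n = cong (lookupᵈ (head t) (toList t)) ([m+kn]%n≡m%n n c ∣ t ∣)

startPos-cong : ∀ {v : ℕ → List⁺ K} {w : ℕ → List⁺ L} →
                (∀ i → ∣ v i ∣ ≡ ∣ w i ∣) → ∀ i → startPos v i ≡ startPos w i
startPos-cong same zero    = refl
startPos-cong same (suc i) = cong₂ _+_ (startPos-cong same i) (same i)

startPos-mono : ∀ (v : ℕ → List⁺ K) {i i′} → i ≤ i′ → startPos v i ≤ startPos v i′
startPos-mono v {i′ = zero}  z≤n = ≤-refl
startPos-mono v {i′ = suc i′} i≤1+i′ with m≤n⇒m<n∨m≡n i≤1+i′
... | inj₂ refl       = ≤-refl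
... | inj₁ (s≤s i≤i′) = ≤-trans (startPos-mono v i≤i′) (m≤m+n _ _)

startPos+offset<startPos : ∀ (v : ℕ → List⁺ K) {i i′ j} → i < i′ → j < ∣ v i ∣ →
                      startPos v i + j < startPos v i′
startPos+offset<startPos v {i} i<i′ j<∣vi∣ =
  <-≤-trans (+-monoʳ-< (startPos v i) j<∣vi∣) (startPos-mono v i<i′)

block-unique : ∀ (v : ℕ → List⁺ K) {i i′ j j′} → j < ∣ v i ∣ → j′ < ∣ v i′ ∣ →
               startPos v i + j ≡ startPos v i′ + j′ → i ≡ i′ × j ≡ j′
block-unique v {i} {i′} j< j′< same with <-cmp i i′
... | tri< i<i′ _ _ =
  ⊥-elim (<-irrefl same (<-≤-trans (startPos+offset<startPos v i<i′ j<) (m≤m+n _ _)))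
... | tri> _ _ i′<i =
  ⊥-elim (<-irrefl (sym same) (<-≤-trans (startPos+offset<startPos v i′<i j′<) (m≤m+n _ _)))
... | tri≈ _ refl _ = refl , +-cancelˡ-≡ (startPos v i) _ _ same

Block : (ℕ → List⁺ K) → ℕ → Set
Block v n = ∃[ i ] ∃[ j ] j < ∣ v i ∣ × startPos v i + j ≡ n

block : ∀ (v : ℕ → List⁺ K) n → Block v n
block v zero = 0 , 0 , z<s , refl
block v (suc n) with block v n
... | i , j , j< , refl with suc j <? ∣ v i ∣
...   | yes 1+j< = i , suc j , 1+j< , +-suc (startPos v i) j
...   | no  1+j≮ = suc i , 0 , z<s , (begin
        startPos v i + ∣ v i ∣ + 0  ≡⟨ +-identityʳ _ ⟩
        startPos v i + ∣ v i ∣      ≡⟨ cong (startPos v i +_) (≤-antisym j< (≮⇒≥ 1+j≮)) ⟨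
        startPos v i + suc j         ≡⟨ +-suc (startPos v i) j ⟩
        suc (startPos v i + j)       ∎)
  where open ≡-Reasoning

concat : (ℕ → List⁺ K) → InfWord K
concat v n with block v n
... | i , j , _ = lookupᵈ (head (v i)) (toList (v i)) j

concat-isConcat : ∀ (v : ℕ → List⁺ K) → IsConcat v (concat v)
concat-isConcat v i j with block v (startPos v i + toℕ j)
... | i′ , j′ , j′< , same with block-unique v j′< (toℕ<n j) same
...   | refl , refl = lookupᵈ-toℕ (head (v i)) (toList (v i)) j

isConcat-unique : ∀ {v : ℕ → List⁺ K} {x y} → IsConcat v x → IsConcat v y → x ≗ y
isConcat-unique {v = v} {x} {y} vx vy n with block v n
... | i , j , j< , refl = begin
  x (startPos v i + j)                     ≡⟨ cong (x ∘ (startPos v i +_)) (toℕ-fromℕ< j<) ⟨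
  x (startPos v i + toℕ (fromℕ< j<))      ≡⟨ trans (vx i (fromℕ< j<)) (sym (vy i (fromℕ< j<))) ⟩
  y (startPos v i + toℕ (fromℕ< j<))      ≡⟨ cong (y ∘ (startPos v i +_)) (toℕ-fromℕ< j<) ⟩
  y (startPos v i + j)                     ∎
  where open ≡-Reasoning

Unfolds : (ℕ → List⁺ K) → InfWord K → Set
Unfolds v x = ∀ i → drop (startPos v i) x ≗ toList (v i) ++ʷ drop (startPos v (suc i)) x

isConcat⇒unfolds : ∀ {v : ℕ → List⁺ K} {x} → IsConcat v x → Unfolds v x
isConcat⇒unfolds {v = v} {x} vx i =
  ++ʷ-intro (toList (v i)) (vx i) (λ n → cong x (sym (+-assoc (startPos v i) ∣ v i ∣ n)))

unfolds⇒isConcat : ∀ {v : ℕ → List⁺ K} {x} → Unfolds v x → IsConcat v x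
unfolds⇒isConcat {v = v} {x} vx i j =
  trans (vx i (toℕ j)) (++ʷ-lookup (toList (v i)) _ j)

unfolds-map : ∀ {v : ℕ → List⁺ K} {w : ℕ → List⁺ L} {x} (h : K → L) →
              (∀ i → mapˡ h (toList (v i)) ≡ toList (w i)) →
              Unfolds v x → Unfolds w (h ∘ x)
unfolds-map {v = v} {w} {x} h hv≡w vx i n = begin
  h (x (startPos w i + n))
    ≡⟨ cong (λ p → h (x (p + n))) (startPos-cong ∣hv∣≡∣w∣ i) ⟨
  h (x (startPos v i + n))
    ≡⟨ cong h (vx i n) ⟩
  h ((toList (v i) ++ʷ drop (startPos v (suc i)) x) n)
    ≡⟨ ++ʷ-map h (toList (v i)) _ n ⟨
  (mapˡ h (toList (v i)) ++ʷ h ∘ drop (startPos v (suc i)) x) n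
    ≡⟨ cong₂ (λ u p → (u ++ʷ h ∘ drop p x) n) (hv≡w i) (startPos-cong ∣hv∣≡∣w∣ (suc i)) ⟩
  (toList (w i) ++ʷ drop (startPos w (suc i)) (h ∘ x)) n ∎
  where
  open ≡-Reasoning
  ∣hv∣≡∣w∣ : ∀ i → ∣ v i ∣ ≡ ∣ w i ∣
  ∣hv∣≡∣w∣ i = trans (sym (length-map h (toList (v i)))) (cong length (hv≡w i))

∈Pair-map : ∀ {x : InfWord K} {s t} (h : K → L) →
            x ∈Pair^ℕ s , t → (h ∘ x) ∈Pair^ℕ map⁺ h s , map⁺ h t
∈Pair-map {x = x} h (v , v∈st , vx) =
  map⁺ h ∘ v ,
  (λ i → map⊎ (cong (map⁺ h)) (cong (map⁺ h)) (v∈st i)) ,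
  unfolds⇒isConcat {x = h ∘ x} (unfolds-map {x = x} h (λ _ → refl) (isConcat⇒unfolds {v = v} {x} vx))

∈Pair-swap : ∀ {x : InfWord K} {s t} → x ∈Pair^ℕ s , t → x ∈Pair^ℕ t , s
∈Pair-swap (v , v∈st , vx) = v , swap⊎ ∘ v∈st , vx

∈Pair-lift : ∀ {x : InfWord K} {s t} {s′ t′ : List⁺ L} (h : L → K) →
             mapˡ h (toList s′) ≡ toList s → mapˡ h (toList t′) ≡ toList t →
             x ∈Pair^ℕ s , t → Σ[ X ∈ InfWord L ] X ∈Pair^ℕ s′ , t′ × h ∘ X ≗ x
∈Pair-lift {L = L} {s′ = s′} {t′} h hs′≡s ht′≡t (v , v∈st , vx) =
  concat v′ , (v′ , v′∈s′t′ , concat-isConcat v′) ,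
  isConcat-unique {v = v}
    (unfolds⇒isConcat {x = h ∘ concat v′}
      (unfolds-map {x = concat v′} h hv′≡v
        (isConcat⇒unfolds {v = v′} {concat v′} (concat-isConcat v′))))
    vx
  where
  v′ : ℕ → List⁺ L
  v′ i with v∈st i
  ... | inj₁ _ = s′
  ... | inj₂ _ = t′

  v′∈s′t′ : ∀ i → v′ i ≡ s′ ⊎ v′ i ≡ t′
  v′∈s′t′ i with v∈st i
  ... | inj₁ _ = inj₁ refl
  ... | inj₂ _ = inj₂ refl

  hv′≡v : ∀ i → mapˡ h (toList (v′ i)) ≡ toList (v i)
  hv′≡v i with v∈st i
  ... | inj₁ refl = hs′≡s
  ... | inj₂ refl = ht′≡t

module _ {B C : Set} (f : B → C) where

  Sound : (B → B) → Set
  Sound κ = ∀ a b → κ a ≡ κ b → f a ≡ f b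

  module _ (_≟_ : DecidableEquality B) where

    merge : (B → B) → B → B → B → B
    merge κ a b c with κ c ≟ κ b
    ... | yes _ = κ a
    ... | no  _ = κ c

    merge-refines : ∀ κ a b {c c′} → κ c ≡ κ c′ → merge κ a b c ≡ merge κ a b c′
    merge-refines κ a b {c} {c′} κc≡κc′ with κ c ≟ κ b | κ c′ ≟ κ b
    ... | yes _   | yes _   = refl
    ... | yes c~b | no  c′≁b = ⊥-elim (c′≁b (trans (sym κc≡κc′) c~b))
    ... | no  c≁b | yes c′~b = ⊥-elim (c≁b (trans κc≡κc′ c′~b))
    ... | no  _   | no  _   = κc≡κc′

    merge-joins : ∀ κ a b → merge κ a b a ≡ merge κ a b b
    merge-joins κ a b with κ a ≟ κ b | κ b ≟ κ b
    ... | _     | no b≁b = ⊥-elim (b≁b refl)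
    ... | yes _ | yes _  = refl
    ... | no  _ | yes _  = refl

    merge-sound : ∀ {κ a b} → Sound κ → f a ≡ f b → Sound (merge κ a b)
    merge-sound {κ} {a} {b} κ-sound fa≡fb c c′ with κ c ≟ κ b | κ c′ ≟ κ b
    ... | yes c~b | yes c′~b = λ _ → trans (κ-sound c b c~b) (sym (κ-sound c′ b c′~b))
    ... | yes c~b | no  _    = λ a~c′ → trans (κ-sound c b c~b) (trans (sym fa≡fb) (κ-sound a c′ a~c′))
    ... | no  _   | yes c′~b = λ c~a → trans (κ-sound c a c~a) (trans fa≡fb (sym (κ-sound c′ b c′~b)))
    ... | no  _   | no  _    = κ-sound c c′

    identify : (ps : List (B × B)) → All (λ (a , b) → f a ≡ f b) ps →
               Σ[ κ ∈ (B → B) ] Sound κ × All (λ (a , b) → κ a ≡ κ b) ps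
    identify []             []            = id , (λ a b → cong f) , []
    identify ((a , b) ∷ ps) (fa≡fb ∷ fps) with identify ps fps
    ... | κ , κ-sound , κps =
      merge κ a b , merge-sound κ-sound fa≡fb , merge-joins κ a b ∷ All.map (merge-refines κ a b) κps

infix 4 _≈[_]_

_≈[_]_ : InfWord K → ℕ → InfWord K → Set
f ≈[ N ] g = ∀ {m} → m < N → f m ≡ g m

≈-sym : ∀ {N} {f g : InfWord K} → f ≈[ N ] g → g ≈[ N ] f
≈-sym f≈g m<N = sym (f≈g m<N)

≗⇒≈ : ∀ {N} {f g : InfWord K} → f ≗ g → f ≈[ N ] g
≗⇒≈ f≗g {m} _ = f≗g m

≈-cons : ∀ {N} {f g : InfWord K} → f 0 ≡ g 0 → drop 1 f ≈[ N ] drop 1 g → f ≈[ suc N ] g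
≈-cons f0≡g0 _     {zero}  _         = f0≡g0
≈-cons _     f′≈g′ {suc m} (s≤s m<N) = f′≈g′ m<N

≈-snoc : ∀ {N} {f g : InfWord K} → f ≈[ N ] g → f N ≡ g N → f ≈[ suc N ] g
≈-snoc f≈g fN≡gN m<1+N with m<1+n⇒m<n∨m≡n m<1+N
... | inj₁ m<N  = f≈g m<N
... | inj₂ refl = fN≡gN

module PrefixOrder {K : Set} {_≺_ : K → K → Set}
                   (≺-trans : Transitive _≺_) (≺-cmp : Trichotomous _≡_ _≺_) where

  infix 4 _<[_]_ _≤[_]_

  _<[_]_ : InfWord K → ℕ → InfWord K → Set
  f <[ N ] g = ∃[ p ] p < N × f ≈[ p ] g × f p ≺ g p

  _≤[_]_ : InfWord K → ℕ → InfWord K → Set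
  f ≤[ N ] g = f <[ N ] g ⊎ f ≈[ N ] g

  private
    variable
      N : ℕ
      f g h : InfWord K

  <ʷ-irrefl : ¬ f <[ N ] f
  <ʷ-irrefl {f = f} (p , _ , _ , fp<fp) with ≺-cmp (f p) (f p)
  ... | tri< _ _ fp≮fp = fp≮fp fp<fp
  ... | tri≈ fp≮fp _ _ = fp≮fp fp<fp
  ... | tri> fp≮fp _ _ = fp≮fp fp<fp

  ≈-<ʷ-trans : f ≈[ N ] g → g <[ N ] h → f <[ N ] h
  ≈-<ʷ-trans {f = f} f≈g (p , p<N , g≈h , gp<hp) =
    p , p<N , (λ m<p → trans (f≈g (<-trans m<p p<N)) (g≈h m<p)) ,
    subst (_≺ _) (sym (f≈g p<N)) gp<hp

  <ʷ-≈-trans : f <[ N ] g → g ≈[ N ] h → f <[ N ] h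
  <ʷ-≈-trans (p , p<N , f≈g , fp<gp) g≈h =
    p , p<N , (λ m<p → trans (f≈g m<p) (g≈h (<-trans m<p p<N))) ,
    subst (_ ≺_) (g≈h p<N) fp<gp

  <ʷ-trans : f <[ N ] g → g <[ N ] h → f <[ N ] h
  <ʷ-trans {f = f} {h = h} (p , p<N , f≈g , fp<gp) (q , q<N , g≈h , gq<hq) with <-cmp p q
  ... | tri< p<q _ _ =
    p , p<N , (λ m<p → trans (f≈g m<p) (g≈h (<-trans m<p p<q))) , subst (f p ≺_) (g≈h p<q) fp<gp
  ... | tri≈ _ refl _ =
    p , p<N , (λ m<p → trans (f≈g m<p) (g≈h m<p)) , ≺-trans fp<gp gq<hq
  ... | tri> _ _ q<p =
    q , q<N , (λ m<q → trans (f≈g (<-trans m<q q<p)) (g≈h m<q)) , subst (_≺ h q) (sym (f≈g q<p)) gq<hq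

  ≤ʷ-<ʷ-trans : f ≤[ N ] g → g <[ N ] h → f <[ N ] h
  ≤ʷ-<ʷ-trans (inj₁ f<g) g<h = <ʷ-trans f<g g<h
  ≤ʷ-<ʷ-trans (inj₂ f≈g) g<h = ≈-<ʷ-trans f≈g g<h

  ≤ʷ-trans : f ≤[ N ] g → g ≤[ N ] h → f ≤[ N ] h
  ≤ʷ-trans f≤g       (inj₁ g<h) = inj₁ (≤ʷ-<ʷ-trans f≤g g<h)
  ≤ʷ-trans (inj₁ f<g) (inj₂ g≈h) = inj₁ (<ʷ-≈-trans f<g g≈h)
  ≤ʷ-trans (inj₂ f≈g) (inj₂ g≈h) = inj₂ (λ m<N → trans (f≈g m<N) (g≈h m<N))

  compareʷ : ∀ N f g → f <[ N ] g ⊎ f ≈[ N ] g ⊎ g <[ N ] f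
  compareʷ zero    f g = inj₂ (inj₁ (λ ()))
  compareʷ (suc N) f g with compareʷ N f g
  ... | inj₁ (p , p<N , f≈g , fp<gp)        = inj₁ (p , m<n⇒m<1+n p<N , f≈g , fp<gp)
  ... | inj₂ (inj₂ (p , p<N , g≈f , gp<fp)) = inj₂ (inj₂ (p , m<n⇒m<1+n p<N , g≈f , gp<fp))
  ... | inj₂ (inj₁ f≈g) with ≺-cmp (f N) (g N)
  ...   | tri< fN<gN _ _    = inj₁ (N , ≤-refl , f≈g , fN<gN)
  ...   | tri≈ _ fN≡gN _    = inj₂ (inj₁ (≈-snoc f≈g fN≡gN))
  ...   | tri> _ _ gN<fN    = inj₂ (inj₂ (N , ≤-refl , ≈-sym f≈g , gN<fN))

  ≤ʷ-shorten : ∀ {M} → M ≤ N → f ≤[ N ] g → f ≤[ M ] g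
  ≤ʷ-shorten {M = M} _ (inj₁ (p , p<N , f≈g , fp<gp)) with p <? M
  ... | yes p<M = inj₁ (p , p<M , f≈g , fp<gp)
  ... | no  p≮M = inj₂ (λ m<M → f≈g (<-≤-trans m<M (≮⇒≥ p≮M)))
  ≤ʷ-shorten M≤N (inj₂ f≈g) = inj₂ (λ m<M → f≈g (<-≤-trans m<M M≤N))

  ≤ʷ-cons : f 0 ≡ g 0 → drop 1 f ≤[ N ] drop 1 g → f ≤[ suc N ] g
  ≤ʷ-cons {f = f} {g = g} f0≡g0 (inj₁ (p , p<N , f′≈g′ , fp<gp)) =
    inj₁ (suc p , s≤s p<N , ≈-cons {f = f} {g = g} f0≡g0 f′≈g′ , fp<gp)
  ≤ʷ-cons {f = f} {g = g} f0≡g0 (inj₂ f′≈g′) = inj₂ (≈-cons {f = f} {g = g} f0≡g0 f′≈g′)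

  ++ʷ-mono : ∀ w → f ≤[ N ] g → (w ++ʷ f) ≤[ length w + N ] (w ++ʷ g)
  ++ʷ-mono []      f≤g = f≤g
  ++ʷ-mono (a ∷ w) f≤g = ≤ʷ-cons refl (++ʷ-mono w f≤g)

  ++ʷ-mono-∸ : ∀ w {M} → f ≤[ M ∸ length w ] g → (w ++ʷ f) ≤[ M ] (w ++ʷ g)
  ++ʷ-mono-∸ w {M} f≤g = ≤ʷ-shorten (m≤n+m∸n M (length w)) (++ʷ-mono w f≤g)

  ^ω-least : ∀ t z → (toList t ++ʷ z) ≤[ N ] z → t ^ω ≤[ N ] z
  ^ω-least {N = N} t z tz≤z = <-rec P step N ≤-refl
    where
    P : ℕ → Set
    P M = M ≤ N → t ^ω ≤[ M ] z

    step : ∀ M → (∀ {M′} → M′ < M → P M′) → P M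
    step zero    _   _   = inj₂ (λ ())
    step (suc M) rec M≤N =
      ≤ʷ-trans (inj₂ (≗⇒≈ (^ω-unfold t)))
        (≤ʷ-trans (++ʷ-mono-∸ (toList t)
                    (rec (suc-∸-∣∣-< M t) (≤-trans (m∸n≤m (suc M) ∣ t ∣) M≤N)))
                  (≤ʷ-shorten M≤N tz≤z))

  ^ω-≤-prepend : ∀ s t → s ^ω ≤[ N ] t ^ω → s ^ω ≤[ N ] (toList t ++ʷ s ^ω)
  ^ω-≤-prepend {N = N} s t s≤t with compareʷ N (s ^ω) (toList t ++ʷ s ^ω)
  ... | inj₁ s<ts        = inj₁ s<ts
  ... | inj₂ (inj₁ s≈ts) = inj₂ s≈ts
  ... | inj₂ (inj₂ ts<s) = ⊥-elim (<ʷ-irrefl (≤ʷ-<ʷ-trans (≤ʷ-trans s≤t t≤ts) ts<s))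
    where
    t≤ts : t ^ω ≤[ N ] toList t ++ʷ s ^ω
    t≤ts = ^ω-least t _ (++ʷ-mono-∸ (toList t) (≤ʷ-shorten (m∸n≤m N ∣ t ∣) (inj₁ ts<s)))

  ^ω-≤-∈Pair : ∀ {y} s t → s ^ω ≤[ N ] t ^ω → y ∈Pair^ℕ s , t → s ^ω ≤[ N ] y
  ^ω-≤-∈Pair {N = N} {y} s t s≤t (v , v∈st , vy) = <-rec P step N ≤-refl 0
    where
    P : ℕ → Set
    P M = M ≤ N → ∀ i → s ^ω ≤[ M ] drop (startPos v i) y

    step : ∀ M → (∀ {M′} → M′ < M → P M′) → P M
    step zero    _   _   i = inj₂ (λ ())
    step (suc M) rec M≤N i =
      ≤ʷ-trans (s≤vi++s (v∈st i))
        (≤ʷ-trans (++ʷ-mono-∸ (toList (v i))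
                    (rec (suc-∸-∣∣-< M (v i)) (≤-trans (m∸n≤m (suc M) ∣ v i ∣) M≤N) (suc i)))
                  (inj₂ (≗⇒≈ (sym ∘ isConcat⇒unfolds {v = v} {y} vy i))))
      where
      s≤vi++s : v i ≡ s ⊎ v i ≡ t → s ^ω ≤[ suc M ] toList (v i) ++ʷ s ^ω
      s≤vi++s (inj₁ refl) = inj₂ (≗⇒≈ (^ω-unfold s))
      s≤vi++s (inj₂ refl) = ≤ʷ-shorten M≤N (^ω-≤-prepend s t s≤t)

  ∈Pair-not-below-both : ∀ {y} s t → y ∈Pair^ℕ s , t → y <[ N ] s ^ω → y <[ N ] t ^ω → ⊥
  ∈Pair-not-below-both {N = N} {y} s t y∈st y<s y<t with compareʷ N (s ^ω) (t ^ω)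
  ... | inj₁ s<t        = <ʷ-irrefl (≤ʷ-<ʷ-trans (^ω-≤-∈Pair s t (inj₁ s<t) y∈st) y<s)
  ... | inj₂ (inj₁ s≈t) = <ʷ-irrefl (≤ʷ-<ʷ-trans (^ω-≤-∈Pair s t (inj₂ s≈t) y∈st) y<s)
  ... | inj₂ (inj₂ t<s) =
    <ʷ-irrefl (≤ʷ-<ʷ-trans (^ω-≤-∈Pair t s (inj₁ t<s) (∈Pair-swap {x = y} y∈st)) y<t)

module PrefixLex {K : Set} {_≺_ : K → K → Set}
                 (≺-trans : Transitive _≺_) (≺-cmp : Trichotomous _≡_ _≺_) where

  open PrefixOrder ≺-trans ≺-cmp public
  private
    module Reversed = PrefixOrder (Flip.trans _≺_ ≺-trans) (Flip.compare _≺_ ≺-cmp)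

  ∈Pair-not-above-both : ∀ {N y} s t → y ∈Pair^ℕ s , t → s ^ω <[ N ] y → t ^ω <[ N ] y → ⊥
  ∈Pair-not-above-both s t y∈st (p , p<N , s≈y , sp≺yp) (q , q<N , t≈y , tq≺yq) =
    Reversed.∈Pair-not-below-both s t y∈st (p , p<N , ≈-sym s≈y , sp≺yp) (q , q<N , ≈-sym t≈y , tq≺yq)

odd-closed-walk-hits-Equal : ∀ {V : Set} (Below Equal Above : V → Set) k (walk : ℕ → V) →
  walk (suc (2 * k)) ≡ walk 0 →
  (∀ v → Below v ⊎ Equal v ⊎ Above v) →
  (∀ e → e < suc (2 * k) → Below (walk e) → Below (walk (suc e)) → ⊥) →
  (∀ e → e < suc (2 * k) → Above (walk e) → Above (walk (suc e)) → ⊥) →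
  ∃[ e ] Equal (walk e)
odd-closed-walk-hits-Equal {V} Below Equal Above k walk closed trichotomy below-edge above-edge =
  start (trichotomy (walk 0))
  where
  Side : Bool → V → Set
  Side true  = Below
  Side false = Above

  Found : Set
  Found = ∃[ e ] Equal (walk e)

  edge : ∀ b e → e < suc (2 * k) → Side b (walk e) → Side b (walk (suc e)) → ⊥
  edge true  = below-edge
  edge false = above-edge

  step : ∀ b e → e < suc (2 * k) → Side b (walk e) → Found ⊎ Side (not b) (walk (suc e))
  step b e e<m side with trichotomy (walk (suc e)) | b
  ... | inj₁ below        | true  = ⊥-elim (edge true e e<m side below)
  ... | inj₁ below        | false = inj₂ below
  ... | inj₂ (inj₁ equal) | _     = inj₁ (suc e , equal)
  ... | inj₂ (inj₂ above) | true  = inj₂ above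
  ... | inj₂ (inj₂ above) | false = ⊥-elim (edge false e e<m side above)

  2+2j≤2k : ∀ {j} → suc j ≤ k → suc (suc (2 * j)) ≤ 2 * k
  2+2j≤2k {j} 1+j≤k = subst (_≤ 2 * k) (*-suc 2 j) (*-monoʳ-≤ 2 1+j≤k)

  even : ∀ b j → j ≤ k → Side b (walk 0) → Found ⊎ Side b (walk (2 * j))
  even b zero    _     side₀ = inj₂ side₀
  even b (suc j) 1+j≤k side₀ with even b j (≤-trans (n≤1+n j) 1+j≤k) side₀
  ... | inj₁ found = inj₁ found
  ... | inj₂ side₂ⱼ with step b (2 * j) (m<n⇒m<1+n (<-trans (n<1+n _) (2+2j≤2k 1+j≤k))) side₂ⱼ
  ...   | inj₁ found = inj₁ found
  ...   | inj₂ side₂ⱼ₊₁ with step (not b) (suc (2 * j)) (m<n⇒m<1+n (2+2j≤2k 1+j≤k)) side₂ⱼ₊₁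
  ...     | inj₁ found = inj₁ found
  ...     | inj₂ side₂ⱼ₊₂ =
    inj₂ (subst₂ Side (not-involutive b) (cong walk (sym (*-suc 2 j))) side₂ⱼ₊₂)

  around : ∀ b → Side b (walk 0) → Found
  around b side₀ with even b k ≤-refl side₀
  ... | inj₁ found  = found
  ... | inj₂ side₂ₖ = ⊥-elim (edge b (2 * k) ≤-refl side₂ₖ (subst (Side b) (sym closed) side₀))

  start : Below (walk 0) ⊎ Equal (walk 0) ⊎ Above (walk 0) → Found
  start (inj₁ below)        = around true below
  start (inj₂ (inj₁ equal)) = 0 , equal
  start (inj₂ (inj₂ above)) = around false above

applyUpTo⁺ : (ℕ → K) → ℕ → List⁺ K
applyUpTo⁺ f n = f 0 ∷ applyUpTo (f ∘ suc) n

startPos-const : ∀ (t : List⁺ K) i → startPos (λ _ → t) i ≡ i * ∣ t ∣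
startPos-const t zero    = refl
startPos-const t (suc i) = trans (cong (_+ ∣ t ∣) (startPos-const t i)) (+-comm (i * ∣ t ∣) ∣ t ∣)

period⇒periodic : ∀ (x : InfWord K) L → 0 < L → (∀ q j → x (j + q * L) ≡ x j) → Periodic x
period⇒periodic x (suc n) _ period = applyUpTo⁺ x n , λ i j → begin
  x (startPos (λ _ → applyUpTo⁺ x n) i + toℕ j)
    ≡⟨ cong (λ p → x (p + toℕ j))
            (trans (startPos-const _ i) (cong (i *_) (length-applyUpTo x (suc n)))) ⟩
  x (i * suc n + toℕ j)   ≡⟨ cong x (+-comm (i * suc n) (toℕ j)) ⟩
  x (toℕ j + i * suc n)   ≡⟨ period i (toℕ j) ⟩
  x (toℕ j)               ≡⟨ lookup-applyUpTo x (suc n) j ⟨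
  lookup (applyUpTo x (suc n)) j ∎
  where open ≡-Reasoning

module Corollary5 {A : Set} (d : A) (x : InfWord A) (k : ℕ) (u : ℕ → List⁺ A)
                  (path : ∀ i → 1 ≤ i → i ≤ 2 * k → x ∈Pair^ℕ u i , u (suc i))
                  (closing : x ∈Pair^ℕ u (suc (2 * k)) , u 1) where

  next : ℕ → ℕ
  next i with i <? suc (2 * k)
  ... | yes _ = suc i
  ... | no  _ = 1

  walk : ℕ → ℕ
  walk zero    = 1
  walk (suc e) = next (walk e)

  next-bounds : ∀ i → 1 ≤ next i × next i ≤ suc (2 * k)
  next-bounds i with i <? suc (2 * k)
  ... | yes i<m = s≤s z≤n , i<m
  ... | no  _   = ≤-refl , s≤s z≤n

  walk-bounds : ∀ e → 1 ≤ walk e × walk e ≤ suc (2 * k)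
  walk-bounds zero    = ≤-refl , s≤s z≤n
  walk-bounds (suc e) = next-bounds (walk e)

  walk-< : ∀ e → e < suc (2 * k) → walk e ≡ suc e
  walk-< zero    _     = refl
  walk-< (suc e) 1+e<m rewrite walk-< e (<-trans (n<1+n e) 1+e<m) with suc e <? suc (2 * k)
  ... | yes _    = refl
  ... | no  1+e≮m = ⊥-elim (1+e≮m 1+e<m)

  walk-closed : walk (suc (2 * k)) ≡ walk 0
  walk-closed rewrite walk-< (2 * k) ≤-refl with suc (2 * k) <? suc (2 * k)
  ... | yes m<m = ⊥-elim (<-irrefl refl m<m)
  ... | no  _   = refl

  edge : ∀ i → 1 ≤ i → i ≤ suc (2 * k) → x ∈Pair^ℕ u i , u (next i)
  edge i 1≤i i≤m with i <? suc (2 * k)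
  ... | yes (s≤s i≤2k) = path i 1≤i i≤2k
  ... | no  i≮m        = subst (λ i → x ∈Pair^ℕ u i , u 1) (≤-antisym (≮⇒≥ i≮m) i≤m) closing

  -- The relabelled alphabet: letter (i , j) is the j-th letter of u i.  The
  -- default d is only read at positions outside the words.
  V : Set
  V = ℕ × ℕ

  ⟦_⟧ : V → A
  ⟦ i , j ⟧ = lookupᵈ d (toList (u i)) j

  positions : ℕ → List⁺ V
  positions i = applyUpTo⁺ (i ,_) (length (tail (u i)))

  ⟦positions⟧ : ∀ i → mapˡ ⟦_⟧ (toList (positions i)) ≡ toList (u i)
  ⟦positions⟧ i = trans (map-applyUpTo (i ,_) ⟦_⟧ ∣ u i ∣) (applyUpTo-lookupᵈ d (toList (u i)))

  ∣map⁺-positions∣ : ∀ (κ : V → V) i → ∣ map⁺ κ (positions i) ∣ ≡ ∣ u i ∣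
  ∣map⁺-positions∣ κ i = trans (length-map κ (toList (positions i))) (length-applyUpTo (i ,_) ∣ u i ∣)

  lifted : ∀ e → Σ[ X ∈ InfWord V ]
             X ∈Pair^ℕ positions (walk e) , positions (walk (suc e)) × ⟦_⟧ ∘ X ≗ x
  lifted e = ∈Pair-lift ⟦_⟧ (⟦positions⟧ _) (⟦positions⟧ _)
               (edge (walk e) (proj₁ (walk-bounds e)) (proj₂ (walk-bounds e)))

  X : ℕ → InfWord V
  X e = proj₁ (lifted e)

  ⟦X⟧ : ∀ e n → ⟦ X e n ⟧ ≡ x n
  ⟦X⟧ e = proj₂ (proj₂ (lifted e))

  _<ᵥ_ : V → V → Set
  _<ᵥ_ = ×-Lex _≡_ _<_ _<_

  <ᵥ-trans : Transitive _<ᵥ_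
  <ᵥ-trans = ×-transitive {_<₂_ = _<_} isEquivalence (resp₂ _<_) <-trans <-trans

  <ᵥ-cmp : Trichotomous _≡_ _<ᵥ_
  <ᵥ-cmp a b with ×-compare sym <-cmp <-cmp a b
  ... | tri< a<b a≢b b≮a = tri< a<b (a≢b ∘ ≡⇒≡×≡) b≮a
  ... | tri≈ a≮b a≡b b≮a = tri≈ a≮b (≡×≡⇒≡ a≡b) b≮a
  ... | tri> a≮b a≢b b<a = tri> a≮b (a≢b ∘ ≡⇒≡×≡) b<a

  open PrefixLex <ᵥ-trans <ᵥ-cmp

  -- The lifted factorisations X e are different words over V; κ identifies
  -- just enough letters to make them agree on the first N positions.
  module AtLength (N : ℕ) where

    agreements : List (V × V)
    agreements = mapˡ (λ (n , e) → X 0 n , X e n) (cartesianProduct (upTo N) (upTo (suc (2 * k))))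

    relabelling : Σ[ κ ∈ (V → V) ] Sound ⟦_⟧ κ × All (λ (a , b) → κ a ≡ κ b) agreements
    relabelling = identify ⟦_⟧ (≡-dec _≟_ _≟_) agreements
      (All-map⁺ (All.universal (λ (n , e) → trans (⟦X⟧ 0 n) (sym (⟦X⟧ e n))) _))

    κ : V → V
    κ = proj₁ relabelling

    y : InfWord V
    y = κ ∘ X 0

    W : ℕ → InfWord V
    W i = map⁺ κ (positions i) ^ω

    factorisations-agree : ∀ e → e < suc (2 * k) → κ ∘ X e ≈[ N ] y
    factorisations-agree e e<m n<N = sym (All.lookup (proj₂ (proj₂ relabelling))
                                     (∈-map⁺ _ (∈-cartesianProduct⁺ (∈-upTo⁺ n<N) (∈-upTo⁺ e<m))))

    relabelled : ∀ e →
      (κ ∘ X e) ∈Pair^ℕ map⁺ κ (positions (walk e)) , map⁺ κ (positions (walk (suc e)))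
    relabelled e = ∈Pair-map {x = X e} κ (proj₁ (proj₂ (lifted e)))

    equal-labels⇒equal-letters : ∀ {n n′} → y n ≡ y n′ → x n ≡ x n′
    equal-labels⇒equal-letters {n} {n′} yn≡yn′ = begin
      x n          ≡⟨ ⟦X⟧ 0 n ⟨
      ⟦ X 0 n ⟧   ≡⟨ proj₁ (proj₂ relabelling) (X 0 n) (X 0 n′) yn≡yn′ ⟩
      ⟦ X 0 n′ ⟧  ≡⟨ ⟦X⟧ 0 n′ ⟩
      x n′         ∎
      where open ≡-Reasoning

    agrees-with-some-power : ∃[ e ] y ≈[ N ] W (walk e)
    agrees-with-some-power =
      odd-closed-walk-hits-Equal (λ v → y <[ N ] W v) (λ v → y ≈[ N ] W v) (λ v → W v <[ N ] y)
        k walk walk-closed (λ v → compareʷ N y (W v))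
        (λ e e<m y<W y<W′ → ∈Pair-not-below-both _ _ (relabelled e)
           (≈-<ʷ-trans (factorisations-agree e e<m) y<W) (≈-<ʷ-trans (factorisations-agree e e<m) y<W′))
        (λ e e<m W<y W′<y → ∈Pair-not-above-both _ _ (relabelled e)
           (<ʷ-≈-trans W<y (≈-sym (factorisations-agree e e<m)))
           (<ʷ-≈-trans W′<y (≈-sym (factorisations-agree e e<m))))

    labels-repeat : ∀ {e} L q j → ∣ u (walk e) ∣ ∣ L → y ≈[ N ] W (walk e) →
                    j + q * L < N → y (j + q * L) ≡ y j
    labels-repeat {e} L q j (divides c L≡c*∣u∣) y≈W j+qL<N = begin
      y (j + q * L)                   ≡⟨ y≈W j+qL<N ⟩
      W (walk e) (j + q * L)          ≡⟨ cong (W (walk e) ∘ (j +_)) q*L≡ ⟩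
      W (walk e) (j + q * c * ∣ w ∣)  ≡⟨ ^ω-periodic w (q * c) j ⟩
      W (walk e) j                    ≡⟨ y≈W (≤-<-trans (m≤m+n j (q * L)) j+qL<N) ⟨
      y j                             ∎
      where
      open ≡-Reasoning
      w : List⁺ V
      w = map⁺ κ (positions (walk e))

      q*L≡ : q * L ≡ q * c * ∣ w ∣
      q*L≡ = begin
        q * L                     ≡⟨ cong (q *_) L≡c*∣u∣ ⟩
        q * (c * ∣ u (walk e) ∣)  ≡⟨ *-assoc q c _ ⟨
        q * c * ∣ u (walk e) ∣    ≡⟨ cong (q * c *_) (∣map⁺-positions∣ κ (walk e)) ⟨
        q * c * ∣ w ∣             ∎

  -- u 0 lies off the cycle; including it keeps the indexing simple.
  period : ℕ
  period = product (applyUpTo (λ i → ∣ u i ∣) (suc (suc (2 * k))))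

  period-pos : 0 < period
  period-pos =
    >-nonZero⁻¹ period {{product≢0 (applyUpTo⁺₂ (λ i → ∣ u i ∣) (suc (suc (2 * k))) (λ _ → _))}}

  ∣u∣∣period : ∀ e → ∣ u (walk e) ∣ ∣ period
  ∣u∣∣period e = ∈⇒∣product (∈-applyUpTo⁺ (λ i → ∣ u i ∣) (s≤s (proj₂ (walk-bounds e))))

  x-periodic : ∀ q j → x (j + q * period) ≡ x j
  x-periodic q j = equal-labels⇒equal-letters (labels-repeat {e} period q j (∣u∣∣period e) y≈W ≤-refl)
    where
    open AtLength (suc (j + q * period))
    e : ℕ
    e = proj₁ agrees-with-some-power
    y≈W : y ≈[ suc (j + q * period) ] W (walk e)
    y≈W = proj₂ agrees-with-some-power

  periodic : Periodic x
  periodic = period⇒periodic x period period-pos x-periodic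

corollary5 : (A : Set) → A → (x : InfWord A) → (k : ℕ) → 1 ≤ k →
    (u : ℕ → List⁺ A) →
    (∀ i → 1 ≤ i → i ≤ 2 * k → x ∈Pair^ℕ u i , u (suc i)) →
    x ∈Pair^ℕ u (suc (2 * k)) , u 1 →
    Periodic x
corollary5 A d x k _ u path closing = Corollary5.periodic d x k u path closing
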